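{- For any $q\in\mathbb{C}$ and $n\ge2$, in $\mathcal{H}_n(q)$, $$\mathcal{B}^*_{n-1}(q)\,T_{s_{n-1}}\,\mathcal{B}_{n-1}(q)\,\mathcal{B}_n(q)=q\,\mathcal{R}_{n-1}(q)\,\mathcal{B}_n(q).$$
   Context: $\mathcal{H}_n(q)$ is the Type A Iwahori–Hecke algebra over $\mathbb{C}$ with generators $T_{s_1},\dots,T_{s_{n-1}}$ and relations $T_{s_i}^2=(q-1)T_{s_i}+q$, $T_{s_i}T_{s_j}=T_{s_j}T_{s_i}$ ($|i-j|\ge2$), $T_{s_i}T_{s_{i+1}}T_{s_i}=T_{s_{i+1}}T_{s_i}T_{s_{i+1}}$; $\mathcal{H}_{n-1}(q)\subseteq\mathcal{H}_n(q)$. $\mathcal{B}_k(q)=\sum_{i=1}^kT_{s_{k-1}}\cdots T_{s_i}$, $\mathcal{B}^*_k(q)=\sum_{i=1}^kT_{s_i}\cdots T_{s_{k-1}}$ (empty products $1$), $\mathcal{R}_k(q)=\mathcal{B}^*_k(q)\mathcal{B}_k(q)$. -}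

module Defs where

open import Level using (Level; _⊔_)
open import Data.Nat using (ℕ; zero; suc; _∸_; _≤_) renaming (_+_ to _+ℕ_)
open import Algebra.Bundles using (CommutativeRing; Ring)
open import Algebra.Morphism.Structures using (module RingMorphisms)

-- Words in the generators T_{s_i} of an associative unital ring A,
-- where T i stands for T_{s_i} (only indices 1 ≤ i ≤ n-1 are ever used).
module Words {a ℓ : Level} (A : Ring a ℓ) (T : ℕ → Ring.Carrier A) where
  open Ring A

  desc : ℕ → ℕ → Carrier
  desc zero    i = 1#
  desc (suc j) i = T (i +ℕ j) * desc j i

  asc : ℕ → ℕ → Carrier
  asc zero    i = 1#
  asc (suc j) i = T i * asc j (suc i)

  sum1 : ℕ → (ℕ → Carrier) → Carrier
  sum1 zero    f = 0#
  sum1 (suc k) f = sum1 k f + f (suc k)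

  B : ℕ → Carrier
  B k = sum1 k (λ i → desc (k ∸ i) i)

  B* : ℕ → Carrier
  B* k = sum1 k (λ i → asc (k ∸ i) i)

  Rk : ℕ → Carrier
  Rk k = B* k * B k

record IsAlgebraMap {c ℓ₁ a ℓ₂ : Level} (R : CommutativeRing c ℓ₁) (A : Ring a ℓ₂)
                    (ι : CommutativeRing.Carrier R → Ring.Carrier A) : Set (c ⊔ ℓ₁ ⊔ a ⊔ ℓ₂) where
  field
    isRingHom : RingMorphisms.IsRingHomomorphism (CommutativeRing.rawRing R) (Ring.rawRing A) ι
    central   : ∀ r x → Ring._≈_ A (Ring._*_ A (ι r) x) (Ring._*_ A x (ι r))

-- Elements T 1, …, T (n-1) of an R-algebra A (structure map ι) satisfying the
-- defining relations of the Iwahori–Hecke algebra H_n(q).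
record HeckeRelations {c ℓ₁ a ℓ₂ : Level} (R : CommutativeRing c ℓ₁) (A : Ring a ℓ₂)
                      (ι : CommutativeRing.Carrier R → Ring.Carrier A)
                      (q : CommutativeRing.Carrier R) (n : ℕ)
                      (T : ℕ → Ring.Carrier A) : Set (a ⊔ ℓ₂) where
  open Ring A
  field
    quadratic : ∀ i → 1 ≤ i → i ≤ n ∸ 1 →
                T i * T i ≈ ι (CommutativeRing._-_ R q (CommutativeRing.1# R)) * T i + ι q
    farComm   : ∀ i j → 1 ≤ i → i +ℕ 2 ≤ j → j ≤ n ∸ 1 →
                T i * T j ≈ T j * T i
    braid     : ∀ i → 1 ≤ i → i +ℕ 1 ≤ n ∸ 1 →
                T i * T (suc i) * T i ≈ T (suc i) * T i * T (suc i)

-- Since B (k+1) = T k · B k + 1, every element T k (1 ≤ k ≤ n-1) acts on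
-- B k · B (k+1) as the scalar q.  Indeed, expanding with the recursion gives
-- B (k+1) · B (k+2) = T k T (k+1) · (B k B (k+1)) + (T (k+1) + 1) · B (k+1),
-- where B k has been moved past T (k+1) by the far commutation relations;
-- multiplying by T (k+1), the braid relation carries the first summand to
-- T k T (k+1) · T k (B k B (k+1)), which is q times the summand by induction,
-- and the quadratic relation reads T (k+1) (T (k+1) + 1) = q (T (k+1) + 1).
-- The theorem is the case k = n-1, multiplied on the left by B* (n-1).
module Submission where

open import Defs
open import Level using (Level)
open import Data.Nat using (ℕ; zero; suc; _≤_; _<_; _∸_; s≤s; z≤n) renaming (_+_ to _+ℕ_)
open import Data.Nat.Properties using (≤-refl; ≤-trans; n≤1+n; n∸n≡0; +-∸-assoc; m+[n∸m]≡n)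
import Data.Nat.Properties as ℕ
open import Algebra.Bundles using (CommutativeRing; Ring)
open import Algebra.Morphism.Structures using (module RingMorphisms)
import Algebra.Properties.Group as GroupProperties
import Relation.Binary.PropositionalEquality as ≡
import Relation.Binary.Reasoning.Setoid as ≈-Reasoning

module WordsProperties {a ℓ : Level} (A : Ring a ℓ) (T : ℕ → Ring.Carrier A) where
  open Ring A
  open Words A T

  sum1-cong : ∀ k {f g : ℕ → Carrier} → (∀ i → i ≤ k → f i ≈ g i) → sum1 k f ≈ sum1 k g
  sum1-cong zero    f≈g = refl
  sum1-cong (suc k) f≈g = +-cong (sum1-cong k (λ i i≤k → f≈g i (≤-trans i≤k (n≤1+n k))))
                                 (f≈g (suc k) ≤-refl)

  *-distribˡ-sum1 : ∀ x k (f : ℕ → Carrier) → x * sum1 k f ≈ sum1 k (λ i → x * f i)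
  *-distribˡ-sum1 x zero    f = zeroʳ x
  *-distribˡ-sum1 x (suc k) f = trans (distribˡ x _ _) (+-congʳ (*-distribˡ-sum1 x k f))

  desc-suc-∸ : ∀ {k i} → i ≤ k → desc (suc k ∸ i) i ≈ T k * desc (k ∸ i) i
  desc-suc-∸ i≤k rewrite +-∸-assoc 1 i≤k | m+[n∸m]≡n i≤k = refl

  B-suc : ∀ k → B (suc k) ≈ T k * B k + 1#
  B-suc k = +-cong first-k-words last-word
    where
    first-k-words : sum1 k (λ i → desc (suc k ∸ i) i) ≈ T k * B k
    first-k-words = trans (sum1-cong k (λ _ → desc-suc-∸))
                          (sym (*-distribˡ-sum1 (T k) k _))
    last-word : desc (k ∸ k) (suc k) ≈ 1#
    last-word rewrite n∸n≡0 k = refl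

module RingProperties {a ℓ : Level} (A : Ring a ℓ) where
  open Ring A
  open ≈-Reasoning setoid

  x*[0*z]≈y*[0*z] : ∀ x y z → x * (0# * z) ≈ y * (0# * z)
  x*[0*z]≈y*[0*z] x y z = begin
    x * (0# * z)   ≈⟨ *-congˡ (zeroˡ z) ⟩
    x * 0#         ≈⟨ zeroʳ x ⟩
    0#             ≈⟨ zeroʳ y ⟨
    y * 0#         ≈⟨ *-congˡ (zeroˡ z) ⟨
    y * (0# * z)   ∎

  affine-comm : ∀ {t c x} → c * x ≈ x * c → t * x ≈ x * t →
                (t * c + 1#) * x ≈ x * (t * c + 1#)
  affine-comm {t} {c} {x} cx≈xc tx≈xt = begin
    (t * c + 1#) * x   ≈⟨ distribʳ x (t * c) 1# ⟩
    t * c * x + 1# * x ≈⟨ +-cong (*-assoc t c x) (*-identityˡ x) ⟩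
    t * (c * x) + x    ≈⟨ +-congʳ (*-congˡ cx≈xc) ⟩
    t * (x * c) + x    ≈⟨ +-congʳ (*-assoc t x c) ⟨
    t * x * c + x      ≈⟨ +-congʳ (*-congʳ tx≈xt) ⟩
    x * t * c + x      ≈⟨ +-cong (*-assoc x t c) (sym (*-identityʳ x)) ⟩
    x * (t * c) + x * 1# ≈⟨ distribˡ x (t * c) 1# ⟨
    x * (t * c + 1#)   ∎

  affine-expand : ∀ {a b c x} → x ≈ b * c + 1# → c * a ≈ a * c →
                  x * (a * x + 1#) ≈ b * a * (c * x) + (a + 1#) * x
  affine-expand {a} {b} {c} {x} x≈bc+1 ca≈ac = begin
    x * (a * x + 1#)        ≈⟨ distribˡ x (a * x) 1# ⟩
    x * (a * x) + x * 1#    ≈⟨ +-cong (sym (*-assoc x a x)) (*-identityʳ x) ⟩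
    x * a * x + x           ≈⟨ +-congʳ (*-congʳ xa≈bac+a) ⟩
    (b * a * c + a) * x + x ≈⟨ +-congʳ (distribʳ x (b * a * c) a) ⟩
    b * a * c * x + a * x + x   ≈⟨ +-assoc _ (a * x) x ⟩
    b * a * c * x + (a * x + x) ≈⟨ +-cong (*-assoc (b * a) c x) (+-congˡ (sym (*-identityˡ x))) ⟩
    b * a * (c * x) + (a * x + 1# * x) ≈⟨ +-congˡ (distribʳ x a 1#) ⟨
    b * a * (c * x) + (a + 1#) * x ∎
    where
    xa≈bac+a : x * a ≈ b * a * c + a
    xa≈bac+a = begin
      x * a                ≈⟨ *-congʳ x≈bc+1 ⟩
      (b * c + 1#) * a     ≈⟨ distribʳ a (b * c) 1# ⟩
      b * c * a + 1# * a   ≈⟨ +-cong (*-assoc b c a) (*-identityˡ a) ⟩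
      b * (c * a) + a      ≈⟨ +-congʳ (*-congˡ ca≈ac) ⟩
      b * (a * c) + a      ≈⟨ +-congʳ (*-assoc b a c) ⟨
      b * a * c + a        ∎

  eigen-step : ∀ {Q a b w y z} → (∀ u → Q * u ≈ u * Q) →
               a * (a + 1#) ≈ Q * (a + 1#) → a * b * a * w ≈ b * a * b * w →
               b * w ≈ Q * w → z ≈ b * a * w + (a + 1#) * y → a * z ≈ Q * z
  eigen-step {Q} {a} {b} {w} {y} {z} Q-central quadratic braid bw≈Qw z≈ = begin
    a * z                                  ≈⟨ *-congˡ z≈ ⟩
    a * (b * a * w + (a + 1#) * y)         ≈⟨ distribˡ a _ _ ⟩
    a * (b * a * w) + a * ((a + 1#) * y)   ≈⟨ +-cong (*-assoc-3 a b a w) (*-assoc a (a + 1#) y) ⟨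
    a * b * a * w + a * (a + 1#) * y       ≈⟨ +-cong braid (*-congʳ quadratic) ⟩
    b * a * b * w + Q * (a + 1#) * y       ≈⟨ +-cong (*-assoc (b * a) b w) (*-assoc Q (a + 1#) y) ⟩
    b * a * (b * w) + Q * ((a + 1#) * y)   ≈⟨ +-congʳ (*-congˡ bw≈Qw) ⟩
    b * a * (Q * w) + Q * ((a + 1#) * y)   ≈⟨ +-congʳ Q-commutes-in ⟩
    Q * (b * a * w) + Q * ((a + 1#) * y)   ≈⟨ distribˡ Q _ _ ⟨
    Q * (b * a * w + (a + 1#) * y)         ≈⟨ *-congˡ z≈ ⟨
    Q * z                                  ∎
    where
    *-assoc-3 : ∀ u v s t → u * v * s * t ≈ u * (v * s * t)
    *-assoc-3 u v s t = trans (*-congʳ (*-assoc u v s)) (*-assoc u (v * s) t)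
    Q-commutes-in : b * a * (Q * w) ≈ Q * (b * a * w)
    Q-commutes-in = begin
      b * a * (Q * w)   ≈⟨ *-assoc (b * a) Q w ⟨
      b * a * Q * w     ≈⟨ *-congʳ (Q-central (b * a)) ⟨
      Q * (b * a) * w   ≈⟨ *-assoc Q (b * a) w ⟩
      Q * (b * a * w)   ∎

module HeckeProperties {c ℓ₁ a ℓ₂ : Level} (R : CommutativeRing c ℓ₁) (A : Ring a ℓ₂)
    (ι : CommutativeRing.Carrier R → Ring.Carrier A) (isAlgebraMap : IsAlgebraMap R A ι)
    (q : CommutativeRing.Carrier R) (n : ℕ)
    (T : ℕ → Ring.Carrier A) (relations : HeckeRelations R A ι q n T) where
  open Ring A
  open Words A T
  open WordsProperties A T
  open RingProperties A
  open IsAlgebraMap isAlgebraMap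
  open HeckeRelations relations
  open ≈-Reasoning setoid
  module R = CommutativeRing R
  open GroupProperties R.+-group using (//-rightDividesˡ)

  ι[q-1]+1≈ιq : ι (q R.- R.1#) + 1# ≈ ι q
  ι[q-1]+1≈ιq = begin
    ι (q R.- R.1#) + 1#        ≈⟨ +-congˡ 1#-homo ⟨
    ι (q R.- R.1#) + ι R.1#    ≈⟨ +-homo (q R.- R.1#) R.1# ⟨
    ι (q R.- R.1# R.+ R.1#)    ≈⟨ ⟦⟧-cong (//-rightDividesˡ R.1# q) ⟩
    ι q                        ∎
    where open RingMorphisms.IsRingHomomorphism isRingHom

  T*[T+1]≈ιq*[T+1] : ∀ i → 1 ≤ i → i ≤ n ∸ 1 → T i * (T i + 1#) ≈ ι q * (T i + 1#)
  T*[T+1]≈ιq*[T+1] i 1≤i i≤n-1 = begin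
    T i * (T i + 1#)                         ≈⟨ distribˡ (T i) (T i) 1# ⟩
    T i * T i + T i * 1#                     ≈⟨ +-cong (quadratic i 1≤i i≤n-1) (*-identityʳ (T i)) ⟩
    ι (q R.- R.1#) * T i + ι q + T i         ≈⟨ +-assoc _ (ι q) (T i) ⟩
    ι (q R.- R.1#) * T i + (ι q + T i)       ≈⟨ +-congˡ (+-comm (ι q) (T i)) ⟩
    ι (q R.- R.1#) * T i + (T i + ι q)       ≈⟨ +-assoc _ (T i) (ι q) ⟨
    ι (q R.- R.1#) * T i + T i + ι q         ≈⟨ +-cong (+-congˡ (*-identityˡ (T i))) (*-identityʳ (ι q)) ⟨
    ι (q R.- R.1#) * T i + 1# * T i + ι q * 1# ≈⟨ +-congʳ (distribʳ (T i) _ 1#) ⟨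
    (ι (q R.- R.1#) + 1#) * T i + ι q * 1#   ≈⟨ +-congʳ (*-congʳ ι[q-1]+1≈ιq) ⟩
    ι q * T i + ι q * 1#                     ≈⟨ distribˡ (ι q) (T i) 1# ⟨
    ι q * (T i + 1#)                         ∎

  B-comm-T : ∀ k j → k < j → j ≤ n ∸ 1 → B k * T j ≈ T j * B k
  B-comm-T zero j _ _ = trans (zeroˡ (T j)) (sym (zeroʳ (T j)))
  B-comm-T (suc zero) j _ _ = begin
    B 1 * T j     ≈⟨ *-congʳ (+-identityˡ 1#) ⟩
    1# * T j      ≈⟨ *-identityˡ (T j) ⟩
    T j           ≈⟨ *-identityʳ (T j) ⟨
    T j * 1#      ≈⟨ *-congˡ (+-identityˡ 1#) ⟨
    T j * B 1     ∎
  B-comm-T (suc (suc k)) j k+2<j j≤n-1 = begin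
    B (suc (suc k)) * T j                  ≈⟨ *-congʳ (B-suc (suc k)) ⟩
    (T (suc k) * B (suc k) + 1#) * T j     ≈⟨ affine-comm (B-comm-T (suc k) j (≤-trans (n≤1+n _) k+2<j) j≤n-1)
                                                        (farComm (suc k) j (s≤s z≤n) far-apart j≤n-1) ⟩
    T j * (T (suc k) * B (suc k) + 1#)     ≈⟨ *-congˡ (B-suc (suc k)) ⟨
    T j * B (suc (suc k))                  ∎
    where
    far-apart : suc k +ℕ 2 ≤ j
    far-apart = ≡.subst (_≤ j) (≡.cong suc (ℕ.+-comm 2 k)) k+2<j

  -- For k = 0 there is no braid relation between T 0 and T 1, but B 0 = 0.
  braid-on-BB : ∀ k → suc k ≤ n ∸ 1 →
                T (suc k) * T k * T (suc k) * (B k * B (suc k))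
                  ≈ T k * T (suc k) * T k * (B k * B (suc k))
  braid-on-BB zero _ = x*[0*z]≈y*[0*z] _ _ _
  braid-on-BB (suc k) k+2≤n-1 = *-congʳ (sym (braid (suc k) (s≤s z≤n) k+2≤n-1′))
    where
    k+2≤n-1′ : suc k +ℕ 1 ≤ n ∸ 1
    k+2≤n-1′ = ≡.subst (_≤ n ∸ 1) (≡.cong suc (ℕ.+-comm 1 k)) k+2≤n-1

  T*BB≈ιq*BB : ∀ k → k ≤ n ∸ 1 → T k * (B k * B (suc k)) ≈ ι q * (B k * B (suc k))
  T*BB≈ιq*BB zero _ = x*[0*z]≈y*[0*z] _ _ _
  T*BB≈ιq*BB (suc k) k+1≤n-1 =
    eigen-step (λ u → central q u)
               (T*[T+1]≈ιq*[T+1] (suc k) (s≤s z≤n) k+1≤n-1)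
               (braid-on-BB k k+1≤n-1)
               (T*BB≈ιq*BB k (≤-trans (n≤1+n k) k+1≤n-1))
               (trans (*-congˡ (B-suc (suc k)))
                      (affine-expand (B-suc k) (B-comm-T k (suc k) ≤-refl k+1≤n-1)))

lemma5p3 : ∀ {c ℓ₁ a ℓ₂} (R : CommutativeRing c ℓ₁) (A : Ring a ℓ₂)
             (ι : CommutativeRing.Carrier R → Ring.Carrier A) → IsAlgebraMap R A ι →
             (q : CommutativeRing.Carrier R) (n : ℕ) → 2 ≤ n →
             (T : ℕ → Ring.Carrier A) → HeckeRelations R A ι q n T →
             let open Ring A
                 open Words A T
             in B* (n ∸ 1) * T (n ∸ 1) * B (n ∸ 1) * B n ≈ ι q * Rk (n ∸ 1) * B n
lemma5p3 R A ι isAlgebraMap q (suc zero) (s≤s ()) T relations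
lemma5p3 R A ι isAlgebraMap q (suc (suc k)) _ T relations = begin
  B* (suc k) * T (suc k) * B (suc k) * B (suc (suc k))     ≈⟨ *-assoc _ (B (suc k)) (B (suc (suc k))) ⟩
  B* (suc k) * T (suc k) * (B (suc k) * B (suc (suc k)))   ≈⟨ *-assoc (B* (suc k)) (T (suc k)) _ ⟩
  B* (suc k) * (T (suc k) * (B (suc k) * B (suc (suc k)))) ≈⟨ *-congˡ (T*BB≈ιq*BB (suc k) ≤-refl) ⟩
  B* (suc k) * (ι q * (B (suc k) * B (suc (suc k))))        ≈⟨ *-assoc (B* (suc k)) (ι q) _ ⟨
  B* (suc k) * ι q * (B (suc k) * B (suc (suc k)))          ≈⟨ *-congʳ (central q (B* (suc k))) ⟨
  ι q * B* (suc k) * (B (suc k) * B (suc (suc k)))          ≈⟨ *-assoc _ (B (suc k)) (B (suc (suc k))) ⟨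
  ι q * B* (suc k) * B (suc k) * B (suc (suc k))            ≈⟨ *-congʳ (*-assoc (ι q) (B* (suc k)) (B (suc k))) ⟩
  ι q * (B* (suc k) * B (suc k)) * B (suc (suc k))          ∎
  where
  open Ring A
  open Words A T
  open HeckeProperties R A ι isAlgebraMap q (suc (suc k)) T relations
  open IsAlgebraMap isAlgebraMap using (central)
  open ≈-Reasoning setoid
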